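{- For integers $n \geq d \geq k \geq 0$, \[ \sum_{\substack{\lambda \vdash n \\ \ell(\lambda) = n-k}} \lambda! \sum_{\substack{\Lambda \in P[n] :\ \Pi(\lambda) \leq \Lambda \\ \#\Lambda = n-d}} |\mu(\Pi(\lambda), \Lambda)| \leq (n-k)^{2d-k}\,(k+1)!. \]
   Context: For an integer partition $\lambda = (\lambda_1 \ge \lambda_2 \ge \cdots) \vdash n$, $\ell(\lambda)$ is its number of parts and $\lambda! := \lambda_1!\,\lambda_2!\cdots$. $P[n]$ denotes the lattice of set partitions of $[n] = \{1,\dots,n\}$, ordered by $\Lambda \le \Pi$ iff $\Pi$ is obtained from $\Lambda$ by merging blocks of $\Lambda$; $\mu(\cdot,\cdot)$ is the Möbius function of this lattice. $\#\Lambda$ denotes the number of blocks of $\Lambda$. $\Pi(\lambda)$ is the set partition $\{\{1,\dots,\lambda_1\}, \{\lambda_1+1,\dots,\lambda_1+\lambda_2\}, \dots\}$ of $[n]$ into consecutive blocks of sizes $\lambda_1, \lambda_2, \ldots$. -}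

module Defs where

open import Data.Bool using (Bool; true; false; _∧_; _∨_; not; if_then_else_)
open import Data.Nat using (ℕ; zero; suc; _+_; _*_; _∸_; _≡ᵇ_; _<ᵇ_)
open import Data.Nat using (_!)
open import Data.Fin using (Fin; toℕ)
open import Data.Vec using (Vec; []; _∷_; lookup; tabulate)
open import Data.Nat.ListAction using (sum; product)
open import Data.List using (List; []; _∷_; map; length; concatMap; allFin; upTo; filterᵇ)
import Data.List as L
open import Data.Integer using (ℤ; ∣_∣) renaming (_+_ to _+ℤ_; -_ to -ℤ_)
import Data.Integer as ℤ

vecsOf : {A : Set} → List A → (m : ℕ) → List (Vec A m)
vecsOf xs zero    = [] ∷ []
vecsOf xs (suc m) = concatMap (λ x → map (x ∷_) (vecsOf xs m)) xs

listsOf : {A : Set} → List A → ℕ → List (List A)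
listsOf xs zero    = [] ∷ []
listsOf xs (suc m) = concatMap (λ x → map (x ∷_) (listsOf xs m)) xs

allᵇ : {A : Set} → (A → Bool) → List A → Bool
allᵇ p []       = true
allᵇ p (x ∷ xs) = p x ∧ allᵇ p xs

anyᵇ : {A : Set} → (A → Bool) → List A → Bool
anyᵇ p []       = false
anyᵇ p (x ∷ xs) = p x ∨ anyᵇ p xs

_⇒ᵇ_ : Bool → Bool → Bool
a ⇒ᵇ b = not a ∨ b

sumℤ : List ℤ → ℤ
sumℤ []       = ℤ.0ℤ
sumℤ (x ∷ xs) = x +ℤ sumℤ xs

-- Integer partitions λ ⊢ n, as weakly decreasing lists of positive parts

nonincreasing : List ℕ → Bool
nonincreasing []           = true
nonincreasing (a ∷ [])     = true
nonincreasing (a ∷ b ∷ xs) = (b <ᵇ suc a) ∧ nonincreasing (b ∷ xs)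

oneTo : ℕ → List ℕ
oneTo n = map suc (upTo n)

partitionsWithLength : (n ℓ : ℕ) → List (List ℕ)
partitionsWithLength n ℓ =
  filterᵇ (λ xs → nonincreasing xs ∧ (sum xs ≡ᵇ n)) (listsOf (oneTo n) ℓ)

partFactorial : List ℕ → ℕ
partFactorial xs = product (map _! xs)

-- Set partitions of [n], represented by their equivalence relation
-- (i ~ j iff i and j lie in the same block), as a Boolean n×n table.
-- Elements of [n] = {1,…,n} are represented by Fin n = {0,…,n-1}.

Rel : ℕ → Set
Rel n = Vec (Vec Bool n) n

rel : {n : ℕ} → Rel n → Fin n → Fin n → Bool
rel R i j = lookup (lookup R i) j

isEquivᵇ : {n : ℕ} → Rel n → Bool
isEquivᵇ {n} R =
  allᵇ (λ i → rel R i i) (allFin n) ∧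
  allᵇ (λ i → allᵇ (λ j → rel R i j ⇒ᵇ rel R j i) (allFin n)) (allFin n) ∧
  allᵇ (λ i → allᵇ (λ j → allᵇ (λ k → (rel R i j ∧ rel R j k) ⇒ᵇ rel R i k)
                                 (allFin n)) (allFin n)) (allFin n)

SetPartitions : (n : ℕ) → List (Rel n)
SetPartitions n =
  filterᵇ isEquivᵇ (vecsOf (vecsOf (false ∷ true ∷ []) n) n)

_≤ᵖ_ : {n : ℕ} → Rel n → Rel n → Bool
_≤ᵖ_ {n} Λ Π =
  allᵇ (λ i → allᵇ (λ j → rel Λ i j ⇒ᵇ rel Π i j) (allFin n)) (allFin n)

-- #Λ: number of blocks = number of elements that are the least of their block
numBlocks : {n : ℕ} → Rel n → ℕ
numBlocks {n} Λ =
  length (filterᵇ (λ i → not (anyᵇ (λ j → (toℕ j <ᵇ toℕ i) ∧ rel Λ j i) (allFin n)))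
                  (allFin n))

-- The fuel argument bounds the length of strict chains; every strict chain
-- in P[n] has fewer than n+1 steps, so fuel (suc n) is sufficient.
mobiusF : {n : ℕ} → ℕ → Rel n → Rel n → ℤ
mobiusF zero    x y = ℤ.0ℤ
mobiusF {n} (suc f) x y =
  if y ≤ᵖ x then ℤ.1ℤ
  else -ℤ sumℤ (map (mobiusF f x)
                  (filterᵇ (λ z → (x ≤ᵖ z) ∧ (z ≤ᵖ y) ∧ not (y ≤ᵖ z))
                           (SetPartitions n)))

μ : {n : ℕ} → Rel n → Rel n → ℤ
μ {n} x y = mobiusF (suc n) x y

-- Π(λ): consecutive blocks of sizes λ₁, λ₂, …
-- segment index of the (0-based) element i
segment : List ℕ → ℕ → ℕ
segment []       i = 0
segment (a ∷ as) i = if i <ᵇ a then 0 else suc (segment as (i ∸ a))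

Πof : (n : ℕ) → List ℕ → Rel n
Πof n xs = tabulate (λ i → tabulate (λ j → segment xs (toℕ i) ≡ᵇ segment xs (toℕ j)))

innerSum : (n d : ℕ) → List ℕ → ℕ
innerSum n d xs =
  sum (map (λ Λ → ∣ μ (Πof n xs) Λ ∣)
           (filterᵇ (λ Λ → (Πof n xs ≤ᵖ Λ) ∧ (numBlocks Λ ≡ᵇ (n ∸ d)))
                    (SetPartitions n)))

lhs : (n d k : ℕ) → ℕ
lhs n d k =
  sum (map (λ xs → partFactorial xs * innerSum n d xs) (partitionsWithLength n (n ∸ k)))

-- Write m = n − k = ℓ(λ) and x = Π(λ); x has c ≤ m blocks.  Unfolding the defining recursion,
-- |μ(x,y)| ≤ [y = x] + Σ_{x ≤ z < y} |μ(x,z)|.  A coarsening y of a partition z ≥ x is determined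
-- by sending every block minimum of z that is not a block minimum of y to the least element of its
-- y-block; this is a pair p < q of block minima of x, so z has at most P^(#z − b) coarsenings with
-- b blocks, where P = c(c−1)/2.  Summing the recursion level by level, the masses
-- M(b) = Σ_{y ≥ x, #y = b} |μ(x,y)| satisfy M(b) ≤ [b = c] + Σ_{b < a ≤ c} P^(a−b) M(a), whence
-- M(b) ≤ (2P)^(c−b) ≤ (m²)^(d−k) for b = n − d.  Finally Σ λ! ≤ m^k (k+1)! over all compositions
-- of n = m + k into m parts, by induction on m, splitting off the first part and using
-- (j+1)! (t+1)! ≤ (j+t+1)! and Σ_{j ≤ k} m^(k−j) ≤ (m+1)^k.

module Submission where

open import Defs
open import Data.Nat using (ℕ; suc; _*_; _∸_; _^_; _≤_)
open import Data.Nat using (_!)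

open import Data.Bool using (Bool; true; false; _∧_; not; if_then_else_; T; T?)
open import Data.Bool.Properties using (T-∧; T-≡)
open import Data.Empty using (⊥-elim)
open import Data.Fin using (Fin; toℕ; zero; suc)
import Data.Fin as Fin
open import Data.Fin.Properties using (toℕ-injective; toℕ<n)
import Data.Fin.Properties as Fin
open import Data.Integer using (ℤ; ∣_∣) renaming (-_ to -ℤ_)
open import Data.Integer.Properties using (∣-i∣≡∣i∣; ∣i+j∣≤∣i∣+∣j∣)
open import Data.List using (List; []; _∷_; _++_; map; length; concatMap; filterᵇ; allFin; upTo; _∷ʳ_)
open import Data.List.Properties using (length-map; length-++; map-++; map-∘; upTo-∷ʳ; map-upTo; length-upTo)
open import Data.List.Membership.Propositional using (_∈_)
open import Data.List.Membership.Propositional.Properties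
  using (∈-map⁺; ∈-map⁻; ∈-++⁺ˡ; ∈-++⁺ʳ; ∈-++⁻; ∈-∃++; ∈-allFin; ∈-filter⁺; ∈-filter⁻; ∈-upTo⁺; ∈-upTo⁻)
open import Data.List.Relation.Unary.All as All using (All; []; _∷_)
open import Data.List.Relation.Unary.Any using (here; there)
open import Data.List.Relation.Unary.AllPairs using (AllPairs)
import Data.List.Relation.Unary.AllPairs.Properties as AllPairs
open import Data.List.Relation.Unary.Unique.Propositional using (Unique; []; _∷_)
import Data.List.Relation.Unary.Unique.Propositional.Properties as Unique
open import Data.Maybe using (Maybe; just; nothing)
import Data.Maybe as Maybe
open import Data.Nat using (zero; _+_; _<_; _≡ᵇ_; _<ᵇ_; z≤n; s≤s)
open import Data.Nat.ListAction using (sum)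
open import Data.Nat.ListAction.Properties using (sum-++)
open import Data.Nat.Properties
open import Data.Nat.Solver using (module +-*-Solver)
open import Data.Product using (∃; _×_; _,_; proj₁; proj₂)
open import Data.Sum using (inj₁; inj₂)
open import Data.Unit using (tt)
open import Data.Vec using ([]; _∷_; lookup; tabulate)
import Data.Vec as Vec
open import Data.Vec.Properties using (tabulate∘lookup; tabulate-cong; lookup∘tabulate; ∷-injectiveʳ)
open import Function using (_∘_; Equivalence)
open import Relation.Binary using (IsEquivalence; Asymmetric; tri<; tri≈; tri>)
open import Relation.Binary.PropositionalEquality
open import Relation.Nullary using (¬_; Dec; contradiction; yes; no)

import Algebra.Properties.CommutativeSemigroup as CommutativeSemigroupProperties
module +-CS = CommutativeSemigroupProperties +-commutativeSemigroup
module *-CS = CommutativeSemigroupProperties *-commutativeSemigroup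

if-true : {A : Set} {b : Bool} {t e : A} → T b → (if b then t else e) ≡ t
if-true {b = true} _ = refl

if-false : {A : Set} {b : Bool} {t e : A} → ¬ T b → (if b then t else e) ≡ e
if-false {b = true}  ¬b = ⊥-elim (¬b tt)
if-false {b = false} _  = refl

if-same : {A : Set} (b : Bool) {a : A} → (if b then a else a) ≡ a
if-same true  = refl
if-same false = refl

*-if : (b : Bool) (k a : ℕ) → k * (if b then a else 0) ≡ (if b then k * a else 0)
*-if true  k a = refl
*-if false k a = *-zeroʳ k

if-+ : (b : Bool) (k l : ℕ) → (if b then k + l else 0) ≡ (if b then k else 0) + (if b then l else 0)
if-+ true  k l = refl
if-+ false k l = refl

if-mono-≤ : (b : Bool) {k l : ℕ} → k ≤ l → (if b then k else 0) ≤ (if b then l else 0)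
if-mono-≤ true  k≤l = k≤l
if-mono-≤ false _   = z≤n

∑ : {A : Set} → List A → (A → ℕ) → ℕ
∑ xs f = sum (map f xs)

module _ {A : Set} where

  ∑-cong : {f g : A → ℕ} (xs : List A) → (∀ {x} → x ∈ xs → f x ≡ g x) → ∑ xs f ≡ ∑ xs g
  ∑-cong []       eq = refl
  ∑-cong (x ∷ xs) eq = cong₂ _+_ (eq (here refl)) (∑-cong xs (eq ∘ there))

  ∑-mono-≤ : {f g : A → ℕ} (xs : List A) → (∀ {x} → x ∈ xs → f x ≤ g x) → ∑ xs f ≤ ∑ xs g
  ∑-mono-≤ []       le = z≤n
  ∑-mono-≤ (x ∷ xs) le = +-mono-≤ (le (here refl)) (∑-mono-≤ xs (le ∘ there))

  ∑-zero : (xs : List A) → ∑ xs (λ _ → 0) ≡ 0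
  ∑-zero []       = refl
  ∑-zero (x ∷ xs) = ∑-zero xs

  ∑-vanishes : {f : A → ℕ} (xs : List A) → (∀ {x} → x ∈ xs → f x ≡ 0) → ∑ xs f ≡ 0
  ∑-vanishes xs eq = trans (∑-cong xs eq) (∑-zero xs)

  ∑-distrib-+ : (f g : A → ℕ) (xs : List A) → ∑ xs (λ x → f x + g x) ≡ ∑ xs f + ∑ xs g
  ∑-distrib-+ f g []       = refl
  ∑-distrib-+ f g (x ∷ xs) = begin
    f x + g x + ∑ xs (λ x → f x + g x)  ≡⟨ cong (f x + g x +_) (∑-distrib-+ f g xs) ⟩
    f x + g x + (∑ xs f + ∑ xs g)       ≡⟨ +-assoc (f x) (g x) _ ⟩
    f x + (g x + (∑ xs f + ∑ xs g))     ≡⟨ cong (f x +_) (+-CS.x∙yz≈y∙xz (g x) (∑ xs f) (∑ xs g)) ⟩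
    f x + (∑ xs f + (g x + ∑ xs g))     ≡⟨ +-assoc (f x) (∑ xs f) _ ⟨
    f x + ∑ xs f + (g x + ∑ xs g)       ∎
    where open ≡-Reasoning

  *-distribˡ-∑ : (k : ℕ) (f : A → ℕ) (xs : List A) → k * ∑ xs f ≡ ∑ xs (λ x → k * f x)
  *-distribˡ-∑ k f []       = *-zeroʳ k
  *-distribˡ-∑ k f (x ∷ xs) = trans (*-distribˡ-+ k (f x) _) (cong (k * f x +_) (*-distribˡ-∑ k f xs))

  ∑-++ : (f : A → ℕ) (xs ys : List A) → ∑ (xs ++ ys) f ≡ ∑ xs f + ∑ ys f
  ∑-++ f xs ys = trans (cong sum (map-++ f xs ys)) (sum-++ (map f xs) (map f ys))

  ∑-filterᵇ : (p : A → Bool) (f : A → ℕ) (xs : List A) →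
              ∑ (filterᵇ p xs) f ≡ ∑ xs (λ x → if p x then f x else 0)
  ∑-filterᵇ p f []       = refl
  ∑-filterᵇ p f (x ∷ xs) with p x
  ... | true  = cong (f x +_) (∑-filterᵇ p f xs)
  ... | false = ∑-filterᵇ p f xs

  ∑-if : (b : Bool) (f : A → ℕ) (xs : List A) →
         (if b then ∑ xs f else 0) ≡ ∑ xs (λ x → if b then f x else 0)
  ∑-if true  f xs = refl
  ∑-if false f xs = sym (∑-zero xs)

  ∑-indicator : (p : A → Bool) (xs : List A) → ∑ xs (λ x → if p x then 1 else 0) ≡ length (filterᵇ p xs)
  ∑-indicator p []       = refl
  ∑-indicator p (x ∷ xs) with p x
  ... | true  = cong suc (∑-indicator p xs)
  ... | false = ∑-indicator p xs

module _ {A B : Set} where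

  ∑-map : (f : B → ℕ) (g : A → B) (xs : List A) → ∑ (map g xs) f ≡ ∑ xs (f ∘ g)
  ∑-map f g xs = cong sum (sym (map-∘ xs))

  ∑-concatMap : (f : B → ℕ) (g : A → List B) (xs : List A) →
                ∑ (concatMap g xs) f ≡ ∑ xs (λ x → ∑ (g x) f)
  ∑-concatMap f g []       = refl
  ∑-concatMap f g (x ∷ xs) = trans (∑-++ f (g x) (concatMap g xs)) (cong (∑ (g x) f +_) (∑-concatMap f g xs))

  ∑-comm : (h : A → B → ℕ) (xs : List A) (ys : List B) →
           ∑ xs (λ x → ∑ ys (h x)) ≡ ∑ ys (λ y → ∑ xs (λ x → h x y))
  ∑-comm h []       ys = sym (∑-zero ys)
  ∑-comm h (x ∷ xs) ys = trans (cong (∑ ys (h x) +_) (∑-comm h xs ys))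
                               (sym (∑-distrib-+ (h x) (λ y → ∑ xs (λ x → h x y)) ys))

∑-upTo-suc : (f : ℕ → ℕ) (N : ℕ) → ∑ (upTo (suc N)) f ≡ f 0 + ∑ (upTo N) (f ∘ suc)
∑-upTo-suc f N = cong (f 0 +_) (trans (cong (λ as → ∑ as f) (sym (map-upTo suc N))) (∑-map f suc (upTo N)))

∑-pick : (h : ℕ → ℕ) {l : ℕ} {as : List ℕ} → Unique as → l ∈ as →
         ∑ as (λ a → if l ≡ᵇ a then h a else 0) ≡ h l
∑-pick h {l} {a ∷ as} (a∉as ∷ uniq) (here refl) rewrite Equivalence.to T-≡ (≡⇒≡ᵇ l l refl) =
  trans (cong (h l +_) (∑-vanishes as λ {a′} a′∈ → off a′ (All.lookup a∉as a′∈))) (+-identityʳ (h l))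
  where
  off : ∀ a′ → l ≢ a′ → (if l ≡ᵇ a′ then h a′ else 0) ≡ 0
  off a′ l≢a′ with l ≡ᵇ a′ in l≡ᵇa′
  ... | true  = ⊥-elim (l≢a′ (≡ᵇ⇒≡ l a′ (Equivalence.from T-≡ l≡ᵇa′)))
  ... | false = refl
∑-pick h {l} {a ∷ as} (a∉as ∷ uniq) (there l∈) with l ≡ᵇ a in l≡ᵇa
... | true  = ⊥-elim (All.lookup a∉as l∈ (sym (≡ᵇ⇒≡ l a (Equivalence.from T-≡ l≡ᵇa))))
... | false = ∑-pick h uniq l∈

∣sumℤ∣≤∑∣∣ : {A : Set} (g : A → ℤ) (xs : List A) → ∣ sumℤ (map g xs) ∣ ≤ ∑ xs (λ x → ∣ g x ∣)
∣sumℤ∣≤∑∣∣ g []       = z≤n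
∣sumℤ∣≤∑∣∣ g (x ∷ xs) = ≤-trans (∣i+j∣≤∣i∣+∣j∣ (g x) _) (+-monoʳ-≤ ∣ g x ∣ (∣sumℤ∣≤∑∣∣ g xs))

T-not⁺ : ∀ {b} → ¬ T b → T (not b)
T-not⁺ {true}  ¬b = ¬b tt
T-not⁺ {false} _  = tt

T-not⁻ : ∀ {b} → T (not b) → ¬ T b
T-not⁻ {false} _ ()

⇒ᵇ⁻ : ∀ {a b} → T (a ⇒ᵇ b) → T a → T b
⇒ᵇ⁻ {true} h _ = h

⇒ᵇ⁺ : ∀ {a b} → (T a → T b) → T (a ⇒ᵇ b)
⇒ᵇ⁺ {true}  h = h tt
⇒ᵇ⁺ {false} h = tt

module _ {A : Set} where

  filterᵇ-⊆-length : (p q : A → Bool) (xs : List A) → (∀ {x} → x ∈ xs → T (p x) → T (q x)) →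
                     length (filterᵇ p xs) ≤ length (filterᵇ q xs)
  filterᵇ-⊆-length p q []       p⇒q = z≤n
  filterᵇ-⊆-length p q (x ∷ xs) p⇒q with p x in px | q x in qx
  ... | true  | true  = s≤s (filterᵇ-⊆-length p q xs (p⇒q ∘ there))
  ... | true  | false = ⊥-elim (subst T qx (p⇒q (here refl) (Equivalence.from T-≡ px)))
  ... | false | true  = m≤n⇒m≤1+n (filterᵇ-⊆-length p q xs (p⇒q ∘ there))
  ... | false | false = filterᵇ-⊆-length p q xs (p⇒q ∘ there)

  filterᵇ-length-≡⇒⊇ : (p q : A → Bool) (xs : List A) → (∀ {x} → x ∈ xs → T (p x) → T (q x)) →
                       length (filterᵇ p xs) ≡ length (filterᵇ q xs) →
                       ∀ {x} → x ∈ xs → T (q x) → T (p x)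
  filterᵇ-length-≡⇒⊇ p q (y ∷ xs) p⇒q eq {x} x∈ qx′ with p y in py | q y in qy
  ... | true  | true  = go x∈
    where
    go : x ∈ y ∷ xs → T (p x)
    go (here refl) = Equivalence.from T-≡ py
    go (there x∈′) = filterᵇ-length-≡⇒⊇ p q xs (p⇒q ∘ there) (suc-injective eq) x∈′ qx′
  ... | true  | false = ⊥-elim (subst T qy (p⇒q (here refl) (Equivalence.from T-≡ py)))
  ... | false | true  = ⊥-elim (<-irrefl eq (s≤s (filterᵇ-⊆-length p q xs (p⇒q ∘ there))))
  ... | false | false = go x∈
    where
    go : x ∈ y ∷ xs → T (p x)
    go (here refl) = ⊥-elim (subst T qy qx′)
    go (there x∈′) = filterᵇ-length-≡⇒⊇ p q xs (p⇒q ∘ there) eq x∈′ qx′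

  filterᵇ-absorb : (p q : A → Bool) (xs : List A) → (∀ {x} → x ∈ xs → T (p x) → T (q x)) →
                   filterᵇ p (filterᵇ q xs) ≡ filterᵇ p xs
  filterᵇ-absorb p q []       p⇒q = refl
  filterᵇ-absorb p q (x ∷ xs) p⇒q with q x in qx | p x in px
  ... | true  | true  rewrite px = cong (x ∷_) (filterᵇ-absorb p q xs (p⇒q ∘ there))
  ... | true  | false rewrite px = filterᵇ-absorb p q xs (p⇒q ∘ there)
  ... | false | true  = ⊥-elim (subst T qx (p⇒q (here refl) (Equivalence.from T-≡ px)))
  ... | false | false = filterᵇ-absorb p q xs (p⇒q ∘ there)

  length-filterᵇ-split : (p : A → Bool) (xs : List A) →
                         length (filterᵇ p xs) + length (filterᵇ (not ∘ p) xs) ≡ length xs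
  length-filterᵇ-split p []       = refl
  length-filterᵇ-split p (x ∷ xs) with p x
  ... | true  = cong suc (length-filterᵇ-split p xs)
  ... | false = trans (+-suc _ _) (cong suc (length-filterᵇ-split p xs))

  ∈-filterᵇ⁻ : (p : A → Bool) {x : A} (xs : List A) → x ∈ filterᵇ p xs → x ∈ xs × T (p x)
  ∈-filterᵇ⁻ p xs = ∈-filter⁻ (T? ∘ p) {xs = xs}

  ∈-filterᵇ⁺ : (p : A → Bool) {x : A} (xs : List A) → x ∈ xs → T (p x) → x ∈ filterᵇ p xs
  ∈-filterᵇ⁺ p xs = ∈-filter⁺ (T? ∘ p) {xs = xs}

  allᵇ⁻ : (p : A → Bool) {xs : List A} → T (allᵇ p xs) → ∀ {x} → x ∈ xs → T (p x)
  allᵇ⁻ p {y ∷ xs} h (here refl) = proj₁ (Equivalence.to T-∧ h)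
  allᵇ⁻ p {y ∷ xs} h (there x∈)  = allᵇ⁻ p (proj₂ (Equivalence.to (T-∧ {p y}) h)) x∈

  allᵇ⁺ : (p : A → Bool) (xs : List A) → (∀ {x} → x ∈ xs → T (p x)) → T (allᵇ p xs)
  allᵇ⁺ p []       h = tt
  allᵇ⁺ p (x ∷ xs) h = Equivalence.from T-∧ (h (here refl) , allᵇ⁺ p xs (h ∘ there))

  anyᵇ⁺ : (p : A → Bool) {xs : List A} {x : A} → x ∈ xs → T (p x) → T (anyᵇ p xs)
  anyᵇ⁺ p {y ∷ xs} (here refl) px with p y
  ... | true = tt
  anyᵇ⁺ p {y ∷ xs} (there x∈) px with p y
  ... | true  = tt
  ... | false = anyᵇ⁺ p x∈ px

  anyᵇ⁻ : (p : A → Bool) (xs : List A) → T (anyᵇ p xs) → ∃ λ x → x ∈ xs × T (p x)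
  anyᵇ⁻ p (x ∷ xs) h with p x in px
  ... | true  = x , here refl , Equivalence.from T-≡ px
  ... | false with anyᵇ⁻ p xs h
  ...   | y , y∈ , py = y , there y∈ , py

module _ {A B : Set} where

  length≤-injection : (f : A → B) {xs : List A} (ys : List B) → Unique xs →
    (∀ {x} → x ∈ xs → f x ∈ ys) →
    (∀ {x x′} → x ∈ xs → x′ ∈ xs → f x ≡ f x′ → x ≡ x′) →
    length xs ≤ length ys
  length≤-injection f {[]}     ys _            _  _   = z≤n
  length≤-injection f {x ∷ xs} ys (x≢xs ∷ uniq) into inj with ∈-∃++ (into (here refl))
  ... | ys₁ , ys₂ , refl = subst (suc (length xs) ≤_) (sym (length-++-∷ ys₁))
        (s≤s (length≤-injection f (ys₁ ++ ys₂) uniq into′ (λ m m′ → inj (there m) (there m′))))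
    where
    length-++-∷ : ∀ zs → length (zs ++ f x ∷ ys₂) ≡ suc (length (zs ++ ys₂))
    length-++-∷ []       = refl
    length-++-∷ (z ∷ zs) = cong suc (length-++-∷ zs)
    remove : ∀ {b} zs → b ∈ zs ++ f x ∷ ys₂ → b ≢ f x → b ∈ zs ++ ys₂
    remove []       (here b≡) b≢ = contradiction b≡ b≢
    remove []       (there m) b≢ = m
    remove (z ∷ zs) (here b≡) b≢ = here b≡
    remove (z ∷ zs) (there m) b≢ = there (remove zs m b≢)
    into′ : ∀ {y} → y ∈ xs → f y ∈ ys₁ ++ ys₂
    into′ {y} m = remove ys₁ (into (there m)) λ fy≡fx → All.lookup x≢xs m (inj (here refl) (there m) (sym fy≡fx))

module _ {A : Set} where

  listsOf-length : (xs : List A) (m : ℕ) → length (listsOf xs m) ≡ length xs ^ m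
  listsOf-length xs zero    = refl
  listsOf-length xs (suc m) = go xs
    where
    go : (ys : List A) → length (concatMap (λ y → map (y ∷_) (listsOf xs m)) ys) ≡ length ys * length xs ^ m
    go []       = refl
    go (y ∷ ys) = trans (length-++ (map (y ∷_) (listsOf xs m)))
                        (cong₂ _+_ (trans (length-map (y ∷_) (listsOf xs m)) (listsOf-length xs m)) (go ys))

  ∈-listsOf⁺ : {xs l : List A} → All (_∈ xs) l → l ∈ listsOf xs (length l)
  ∈-listsOf⁺ {xs} {[]}    []           = here refl
  ∈-listsOf⁺ {xs} {a ∷ l} (a∈ ∷ l⊆xs) = go xs a∈
    where
    go : (ys : List A) → a ∈ ys → a ∷ l ∈ concatMap (λ y → map (y ∷_) (listsOf xs (length l))) ys
    go (y ∷ ys) (here refl) = ∈-++⁺ˡ (∈-map⁺ (a ∷_) (∈-listsOf⁺ l⊆xs))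
    go (y ∷ ys) (there a∈′) = ∈-++⁺ʳ (map (y ∷_) (listsOf xs (length l))) (go ys a∈′)

  ∈-listsOf⁻ : {xs l : List A} (m : ℕ) → l ∈ listsOf xs m → length l ≡ m × All (_∈ xs) l
  ∈-listsOf⁻ {xs} zero    (here refl) = refl , []
  ∈-listsOf⁻ {xs} (suc m) l∈ = go xs (λ a∈ → a∈) l∈
    where
    go : ∀ {l} (ys : List A) → (∀ {a} → a ∈ ys → a ∈ xs) →
         l ∈ concatMap (λ y → map (y ∷_) (listsOf xs m)) ys → length l ≡ suc m × All (_∈ xs) l
    go (y ∷ ys) ys⊆xs l∈ with ∈-++⁻ (map (y ∷_) (listsOf xs m)) l∈
    ... | inj₂ l∈′ = go ys (ys⊆xs ∘ there) l∈′
    ... | inj₁ l∈′ with ∈-map⁻ (y ∷_) l∈′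
    ...   | l′ , l′∈ , refl with ∈-listsOf⁻ m l′∈
    ...     | len , l′⊆xs = cong suc len , ys⊆xs (here refl) ∷ l′⊆xs

  vecsOf-unique : {xs : List A} → Unique xs → (m : ℕ) → Unique (vecsOf xs m)
  vecsOf-unique uniq zero    = [] ∷ []
  vecsOf-unique {xs} uniq (suc m) = go uniq
    where
    V = vecsOf xs m
    head∈ : ∀ {v} ys → v ∈ concatMap (λ y → map (y ∷_) V) ys → Vec.head v ∈ ys
    head∈ (y ∷ ys) v∈ with ∈-++⁻ (map (y ∷_) V) v∈
    ... | inj₂ v∈′ = there (head∈ ys v∈′)
    ... | inj₁ v∈′ with ∈-map⁻ (y ∷_) v∈′
    ...   | _ , _ , refl = here refl
    go : ∀ {ys} → Unique ys → Unique (concatMap (λ y → map (y ∷_) V) ys)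
    go {[]}     []          = []
    go {y ∷ ys} (y∉ys ∷ ys-unique) =
      Unique.++⁺ (Unique.map⁺ ∷-injectiveʳ (vecsOf-unique uniq m)) (go ys-unique) disjoint
      where
      disjoint : ∀ {v} → ¬ (v ∈ map (y ∷_) V × v ∈ concatMap (λ y → map (y ∷_) V) ys)
      disjoint (v∈ , v∈′) with ∈-map⁻ (y ∷_) v∈
      ... | _ , _ , refl = All.lookup y∉ys (head∈ ys v∈′) refl

  pairs : List A → List (A × A)
  pairs []       = []
  pairs (x ∷ xs) = map (x ,_) xs ++ pairs xs

  length-pairs : (xs : List A) → 2 * length (pairs xs) ≤ length xs * length xs
  length-pairs []       = z≤n
  length-pairs (x ∷ xs) = begin
    2 * length (map (x ,_) xs ++ pairs xs)
      ≡⟨ cong (2 *_) (trans (length-++ (map (x ,_) xs)) (cong (_+ p) (length-map (x ,_) xs))) ⟩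
    2 * (l + p)          ≡⟨ *-distribˡ-+ 2 l p ⟩
    2 * l + 2 * p        ≤⟨ +-monoʳ-≤ (2 * l) (length-pairs xs) ⟩
    2 * l + l * l        ≤⟨ n≤1+n _ ⟩
    suc (2 * l + l * l)  ≡⟨ solve 1 (λ l → con 1 :+ (con 2 :* l :+ l :* l) := (con 1 :+ l) :* (con 1 :+ l)) refl l ⟩
    suc l * suc l        ∎
    where
    open ≤-Reasoning
    open +-*-Solver
    l = length xs
    p = length (pairs xs)

  ∈-pairs⁺ : {_<_ : A → A → Set} → Asymmetric _<_ → {xs : List A} → AllPairs _<_ xs →
             ∀ {a b} → a ∈ xs → b ∈ xs → a < b → (a , b) ∈ pairs xs
  ∈-pairs⁺ asym {x ∷ xs} (x<xs ∷ sorted) (here refl) (here refl) a<b = ⊥-elim (asym a<b a<b)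
  ∈-pairs⁺ asym {x ∷ xs} (x<xs ∷ sorted) (here refl) (there b∈) a<b = ∈-++⁺ˡ (∈-map⁺ (x ,_) b∈)
  ∈-pairs⁺ asym {x ∷ xs} (x<xs ∷ sorted) (there a∈) (here refl) a<b = ⊥-elim (asym a<b (All.lookup x<xs a∈))
  ∈-pairs⁺ asym {x ∷ xs} (x<xs ∷ sorted) (there a∈) (there b∈) a<b =
    ∈-++⁺ʳ (map (x ,_) xs) (∈-pairs⁺ asym sorted a∈ b∈ a<b)

-- Set partitions

least : ∀ {n} → (Fin n → Bool) → Maybe (Fin n)
least {zero}  p = nothing
least {suc n} p = if p zero then just zero else Maybe.map suc (least (p ∘ suc))

least-correct : ∀ {n} (p : Fin n → Bool) {i} → T (p i) →
  ∃ λ k → least p ≡ just k × T (p k) × (∀ {j} → toℕ j < toℕ k → ¬ T (p j))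
least-correct {suc n} p {i} pi with p zero in p0
... | true  = zero , refl , Equivalence.from T-≡ p0 , λ ()
... | false with i
...   | zero  = ⊥-elim (subst T p0 pi)
...   | suc i′ with least-correct (p ∘ suc) pi
...     | k , eq , pk , below = suc k , cong (Maybe.map suc) eq , pk , minimal
  where
  minimal : ∀ {j} → toℕ j < suc (toℕ k) → ¬ T (p j)
  minimal {zero}  _         = subst T p0
  minimal {suc j} (s≤s j<k) = below j<k

module _ {n : ℕ} where

  infix 4 _∼[_]_ _⊑_

  -- A record rather than T (rel R i j), so that i, R and j can be inferred from a proof.
  record _∼[_]_ (i : Fin n) (R : Rel n) (j : Fin n) : Set where
    constructor related
    field related? : T (rel R i j)
  open _∼[_]_

  _⊑_ : Rel n → Rel n → Set
  Λ ⊑ Π = ∀ {i j} → i ∼[ Λ ] j → i ∼[ Π ] j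

  ≤ᵖ⇒⊑ : ∀ Λ Π → T (Λ ≤ᵖ Π) → Λ ⊑ Π
  ≤ᵖ⇒⊑ Λ Π h {i} {j} (related i∼j) = related (⇒ᵇ⁻ (allᵇ⁻ _ (allᵇ⁻ _ h (∈-allFin i)) (∈-allFin j)) i∼j)

  ⊑⇒≤ᵖ : ∀ Λ Π → Λ ⊑ Π → T (Λ ≤ᵖ Π)
  ⊑⇒≤ᵖ Λ Π h = allᵇ⁺ _ (allFin n) λ _ → allᵇ⁺ _ (allFin n) λ _ → ⇒ᵇ⁺ (related? ∘ h ∘ related)

  IsPartition : Rel n → Set
  IsPartition R = IsEquivalence (_∼[ R ]_)

  isEquivᵇ⇒IsPartition : ∀ R → T (isEquivᵇ R) → IsPartition R
  isEquivᵇ⇒IsPartition R h = record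
    { refl  = λ {i} → related (allᵇ⁻ _ r (∈-allFin i))
    ; sym   = λ {i} {j} i∼j → related (⇒ᵇ⁻ (allᵇ⁻ _ (allᵇ⁻ _ s (∈-allFin i)) (∈-allFin j)) (related? i∼j))
    ; trans = λ {i} {j} {k} i∼j j∼k → related
        (⇒ᵇ⁻ (allᵇ⁻ _ (allᵇ⁻ _ (allᵇ⁻ _ t (∈-allFin i)) (∈-allFin j)) (∈-allFin k))
             (Equivalence.from T-∧ (related? i∼j , related? j∼k)))
    }
    where
    reflexiveᵇ symmetricᵇ transitiveᵇ : Bool
    reflexiveᵇ  = allᵇ (λ i → rel R i i) (allFin n)
    symmetricᵇ  = allᵇ (λ i → allᵇ (λ j → rel R i j ⇒ᵇ rel R j i) (allFin n)) (allFin n)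
    transitiveᵇ = allᵇ (λ i → allᵇ (λ j → allᵇ (λ k → (rel R i j ∧ rel R j k) ⇒ᵇ rel R i k)
                                          (allFin n)) (allFin n)) (allFin n)
    r = proj₁ (Equivalence.to (T-∧ {reflexiveᵇ}) h)
    s = proj₁ (Equivalence.to (T-∧ {symmetricᵇ}) (proj₂ (Equivalence.to (T-∧ {reflexiveᵇ}) h)))
    t = proj₂ (Equivalence.to (T-∧ {symmetricᵇ}) (proj₂ (Equivalence.to (T-∧ {reflexiveᵇ}) h)))

  ⊑-antisym : ∀ {R S : Rel n} → R ⊑ S → S ⊑ R → R ≡ S
  ⊑-antisym {R} {S} R⊑S S⊑R = begin
    R                            ≡⟨ tabulate∘lookup R ⟨
    tabulate (λ i → lookup R i)  ≡⟨ tabulate-cong row ⟩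
    tabulate (λ i → lookup S i)  ≡⟨ tabulate∘lookup S ⟩
    S                            ∎
    where
    open ≡-Reasoning
    entry : ∀ i j → rel R i j ≡ rel S i j
    entry i j with rel R i j in r | rel S i j in s
    ... | true  | true  = refl
    ... | false | false = refl
    ... | true  | false = ⊥-elim (subst T s (related? (R⊑S (related (Equivalence.from T-≡ r)))))
    ... | false | true  = ⊥-elim (subst T r (related? (S⊑R (related (Equivalence.from T-≡ s)))))
    row : ∀ i → lookup R i ≡ lookup S i
    row i = trans (sym (tabulate∘lookup (lookup R i)))
                  (trans (tabulate-cong (entry i)) (tabulate∘lookup (lookup S i)))

  IsBlockMin : Rel n → Fin n → Set
  IsBlockMin R i = ∀ {j} → toℕ j < toℕ i → ¬ j ∼[ R ] i

  isBlockMin : Rel n → Fin n → Bool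
  isBlockMin R i = not (anyᵇ (λ j → (toℕ j <ᵇ toℕ i) ∧ rel R j i) (allFin n))

  blockMins : Rel n → List (Fin n)
  blockMins R = filterᵇ (isBlockMin R) (allFin n)

  isBlockMin⇒IsBlockMin : ∀ R i → T (isBlockMin R i) → IsBlockMin R i
  isBlockMin⇒IsBlockMin R i h {j} j<i (related j∼i)
    with anyᵇ (λ j → (toℕ j <ᵇ toℕ i) ∧ rel R j i) (allFin n)
       | anyᵇ⁺ (λ j → (toℕ j <ᵇ toℕ i) ∧ rel R j i) (∈-allFin j) (Equivalence.from T-∧ (<⇒<ᵇ j<i , j∼i))
  ... | true | _ = h

  IsBlockMin⇒isBlockMin : ∀ R i → IsBlockMin R i → T (isBlockMin R i)
  IsBlockMin⇒isBlockMin R i h with anyᵇ (λ j → (toℕ j <ᵇ toℕ i) ∧ rel R j i) (allFin n) in any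
  ... | false = tt
  ... | true with anyᵇ⁻ _ (allFin n) (Equivalence.from T-≡ any)
  ...   | j , _ , j<i∧j∼i with Equivalence.to T-∧ j<i∧j∼i
  ...     | j<i , j∼i = h (<ᵇ⇒< _ _ j<i) (related j∼i)

  ∈-blockMins⁻ : ∀ {R i} → i ∈ blockMins R → IsBlockMin R i
  ∈-blockMins⁻ {R} {i} i∈ = isBlockMin⇒IsBlockMin R i (proj₂ (∈-filterᵇ⁻ (isBlockMin R) (allFin n) i∈))

  ∈-blockMins⁺ : ∀ {R i} → IsBlockMin R i → i ∈ blockMins R
  ∈-blockMins⁺ {R} {i} h = ∈-filterᵇ⁺ (isBlockMin R) (allFin n) (∈-allFin i) (IsBlockMin⇒isBlockMin R i h)

  IsBlockMin-antitone : ∀ {Λ Π i} → Λ ⊑ Π → IsBlockMin Π i → IsBlockMin Λ i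
  IsBlockMin-antitone Λ⊑Π h j<i = h j<i ∘ Λ⊑Π

  isBlockMin-antitone : ∀ {Λ Π} → Λ ⊑ Π → ∀ i → T (isBlockMin Π i) → T (isBlockMin Λ i)
  isBlockMin-antitone {Λ} {Π} Λ⊑Π i =
    IsBlockMin⇒isBlockMin Λ i ∘ IsBlockMin-antitone Λ⊑Π ∘ isBlockMin⇒IsBlockMin Π i

  numBlocks-antitone : ∀ {Λ Π} → Λ ⊑ Π → numBlocks Π ≤ numBlocks Λ
  numBlocks-antitone {Λ} {Π} Λ⊑Π =
    filterᵇ-⊆-length (isBlockMin Π) (isBlockMin Λ) (allFin n) λ {i} _ → isBlockMin-antitone Λ⊑Π i

  -- The default i is never used when R is reflexive.
  leader : Rel n → Fin n → Fin n
  leader R i = Maybe.fromMaybe i (least (λ j → rel R j i))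

  module Leader {R : Rel n} (E : IsPartition R) where

    open IsEquivalence E renaming (refl to ∼-refl; sym to ∼-sym; trans to ∼-trans)

    leader-minimal : ∀ i → leader R i ∼[ R ] i × (∀ {j} → toℕ j < toℕ (leader R i) → ¬ j ∼[ R ] i)
    leader-minimal i with least-correct (λ j → rel R j i) (related? (∼-refl {i}))
    ... | k , eq , k∼i , below rewrite eq = related k∼i , λ j<k j∼i → below j<k (related? j∼i)

    leader-∼ : ∀ i → leader R i ∼[ R ] i
    leader-∼ i = proj₁ (leader-minimal i)

    leader-≤ : ∀ i → toℕ (leader R i) ≤ toℕ i
    leader-≤ i = ≮⇒≥ λ i<leader → proj₂ (leader-minimal i) i<leader ∼-refl

    leader-isBlockMin : ∀ i → IsBlockMin R (leader R i)
    leader-isBlockMin i j<leader j∼leader = proj₂ (leader-minimal i) j<leader (∼-trans j∼leader (leader-∼ i))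

    blockMin-unique : ∀ {p q} → IsBlockMin R p → IsBlockMin R q → p ∼[ R ] q → p ≡ q
    blockMin-unique {p} {q} min-p min-q p∼q with <-cmp (toℕ p) (toℕ q)
    ... | tri< p<q _ _ = ⊥-elim (min-q p<q p∼q)
    ... | tri≈ _ p≡q _ = toℕ-injective p≡q
    ... | tri> _ _ q<p = ⊥-elim (min-p q<p (∼-sym p∼q))

    leader-blockMin : ∀ {p} → IsBlockMin R p → leader R p ≡ p
    leader-blockMin {p} min-p = blockMin-unique (leader-isBlockMin p) min-p (leader-∼ p)

    leader-cong : ∀ {i j} → i ∼[ R ] j → leader R i ≡ leader R j
    leader-cong {i} {j} i∼j = blockMin-unique (leader-isBlockMin i) (leader-isBlockMin j)
      (∼-trans (leader-∼ i) (∼-trans i∼j (∼-sym (leader-∼ j))))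

    leader-≡⇒∼ : ∀ {i j} → leader R i ≡ leader R j → i ∼[ R ] j
    leader-≡⇒∼ {i} {j} eq = ∼-trans (∼-sym (leader-∼ i)) (subst (_∼[ R ] j) (sym eq) (leader-∼ j))

    leader-< : ∀ {p} → ¬ IsBlockMin R p → toℕ (leader R p) < toℕ p
    leader-< {p} ¬min-p with m≤n⇒m<n∨m≡n (leader-≤ p)
    ... | inj₁ leader<p = leader<p
    ... | inj₂ leader≡p = ⊥-elim (¬min-p (subst (IsBlockMin R) (toℕ-injective leader≡p) (leader-isBlockMin p)))

  ⊑-numBlocks-≡ : ∀ {Λ Π} → IsPartition Λ → IsPartition Π → Λ ⊑ Π → numBlocks Π ≡ numBlocks Λ → Π ⊑ Λ
  ⊑-numBlocks-≡ {Λ} {Π} EΛ EΠ Λ⊑Π same {i} {j} i∼j =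
    Λ.leader-≡⇒∼ (Π.blockMin-unique (blockMinΠ i) (blockMinΠ j) leaders-∼)
    where
    module Λ = Leader EΛ
    module Π = Leader EΠ
    open IsEquivalence EΠ renaming (sym to ∼-sym; trans to ∼-trans)
    blockMinΠ : ∀ k → IsBlockMin Π (leader Λ k)
    blockMinΠ k = isBlockMin⇒IsBlockMin Π (leader Λ k)
      (filterᵇ-length-≡⇒⊇ (isBlockMin Π) (isBlockMin Λ) (allFin n) (λ {p} _ → isBlockMin-antitone Λ⊑Π p) same
        (∈-allFin _) (IsBlockMin⇒isBlockMin Λ _ (Λ.leader-isBlockMin k)))
    leaders-∼ : leader Λ i ∼[ Π ] leader Λ j
    leaders-∼ = ∼-trans (Λ⊑Π (Λ.leader-∼ i)) (∼-trans i∼j (∼-sym (Λ⊑Π (Λ.leader-∼ j))))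

  SetPartitions-unique : Unique (SetPartitions n)
  SetPartitions-unique = Unique.filter⁺ (T? ∘ isEquivᵇ) (vecsOf-unique (vecsOf-unique bools-unique n) n)
    where
    bools-unique : Unique (false ∷ true ∷ [])
    bools-unique = ((λ ()) ∷ []) ∷ [] ∷ []

  ∈-SetPartitions⇒IsPartition : ∀ {R} → R ∈ SetPartitions n → IsPartition R
  ∈-SetPartitions⇒IsPartition {R} R∈ =
    isEquivᵇ⇒IsPartition R (proj₂ (∈-filterᵇ⁻ isEquivᵇ (vecsOf (vecsOf (false ∷ true ∷ []) n) n) R∈))

  blockMins-sorted : (R : Rel n) → AllPairs Fin._<_ (blockMins R)
  blockMins-sorted R = AllPairs.filter⁺ (T? ∘ isBlockMin R) (AllPairs.tabulate⁺-< (λ i<j → i<j))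

  blockMins-unique : (R : Rel n) → Unique (blockMins R)
  blockMins-unique R = Unique.filter⁺ (T? ∘ isBlockMin R) (Unique.allFin⁺ n)

  kernel : (Fin n → ℕ) → Rel n
  kernel f = tabulate (λ i → tabulate (λ j → f i ≡ᵇ f j))

  rel-kernel : ∀ f i j → rel (kernel f) i j ≡ (f i ≡ᵇ f j)
  rel-kernel f i j = trans (cong (λ row → lookup row j) (lookup∘tabulate _ i)) (lookup∘tabulate _ j)

  ∼-kernel⁻ : ∀ f {i j} → i ∼[ kernel f ] j → f i ≡ f j
  ∼-kernel⁻ f {i} {j} (related i∼j) = ≡ᵇ⇒≡ (f i) (f j) (subst T (rel-kernel f i j) i∼j)

  ∼-kernel⁺ : ∀ f {i j} → f i ≡ f j → i ∼[ kernel f ] j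
  ∼-kernel⁺ f {i} {j} fi≡fj = related (subst T (sym (rel-kernel f i j)) (≡⇒≡ᵇ (f i) (f j) fi≡fj))

  kernel-IsPartition : ∀ f → IsPartition (kernel f)
  kernel-IsPartition f = record
    { refl  = ∼-kernel⁺ f refl
    ; sym   = ∼-kernel⁺ f ∘ sym ∘ ∼-kernel⁻ f
    ; trans = λ i∼j j∼k → ∼-kernel⁺ f (trans (∼-kernel⁻ f i∼j) (∼-kernel⁻ f j∼k))
    }

  numBlocks-kernel : ∀ {f m} → (∀ i → f i < m) → numBlocks (kernel f) ≤ m
  numBlocks-kernel {f} {m} f<m = subst (numBlocks (kernel f) ≤_) (length-upTo m)
    (length≤-injection f (upTo m) (blockMins-unique (kernel f)) (λ {i} _ → ∈-upTo⁺ (f<m i))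
      λ p∈ q∈ fp≡fq → blockMin-unique (∈-blockMins⁻ p∈) (∈-blockMins⁻ q∈) (∼-kernel⁺ f fp≡fq))
    where open Leader (kernel-IsPartition f)

-- Counting coarsenings

coarseningAt : ∀ {n} → Rel n → ℕ → Rel n → Bool
coarseningAt z b y = (z ≤ᵖ y) ∧ (numBlocks y ≡ᵇ b)

module Coarsenings {n : ℕ} (x z : Rel n) (Ez : IsPartition z) (x⊑z : x ⊑ z) where

  nonBlockMins : Rel n → List (Fin n)
  nonBlockMins y = filterᵇ (not ∘ isBlockMin y) (blockMins z)

  encode : Rel n → List (Fin n × Fin n)
  encode y = map (λ p → leader y p , p) (nonBlockMins y)

  encode-length : ∀ {y} → z ⊑ y → length (encode y) ≡ numBlocks z ∸ numBlocks y
  encode-length {y} z⊑y = begin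
    length (encode y)                              ≡⟨ length-map _ (nonBlockMins y) ⟩
    length (nonBlockMins y)                        ≡⟨ m+n∸m≡n (numBlocks y) _ ⟨
    numBlocks y + length (nonBlockMins y) ∸ numBlocks y
      ≡⟨ cong (λ ps → length ps + length (nonBlockMins y) ∸ numBlocks y)
              (filterᵇ-absorb (isBlockMin y) (isBlockMin z) (allFin n) (λ {p} _ → isBlockMin-antitone z⊑y p)) ⟨
    length (filterᵇ (isBlockMin y) (blockMins z)) + length (nonBlockMins y) ∸ numBlocks y
      ≡⟨ cong (_∸ numBlocks y) (length-filterᵇ-split (isBlockMin y) (blockMins z)) ⟩
    numBlocks z ∸ numBlocks y                      ∎
    where open ≡-Reasoning

  encode-pairs : ∀ {y} → IsPartition y → z ⊑ y → All (_∈ pairs (blockMins x)) (encode y)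
  encode-pairs {y} Ey z⊑y = All.tabulate λ pair∈ → pair∈pairs (∈-map⁻ (λ p → leader y p , p) pair∈)
    where
    open Leader Ey
    pair∈pairs : ∀ {pair} → ∃ (λ p → p ∈ nonBlockMins y × pair ≡ (leader y p , p)) → pair ∈ pairs (blockMins x)
    pair∈pairs (p , p∈ , refl) with ∈-filterᵇ⁻ (not ∘ isBlockMin y) (blockMins z) p∈
    ... | p∈z , ¬min-y = ∈-pairs⁺ Fin.<-asym (blockMins-sorted x)
      (∈-blockMins⁺ (IsBlockMin-antitone x⊑z (IsBlockMin-antitone z⊑y (leader-isBlockMin p))))
      (∈-blockMins⁺ (IsBlockMin-antitone x⊑z (∈-blockMins⁻ p∈z)))
      (leader-< λ min-y → T-not⁻ ¬min-y (IsBlockMin⇒isBlockMin y p min-y))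

  ∈-encode⁻ : ∀ {y a p} → (a , p) ∈ encode y → a ≡ leader y p
  ∈-encode⁻ {y} a,p∈ with ∈-map⁻ (λ q → leader y q , q) a,p∈
  ... | _ , _ , refl = refl

  ∈-encode⁺ : ∀ {y p} → p ∈ blockMins z → ¬ T (isBlockMin y p) → (leader y p , p) ∈ encode y
  ∈-encode⁺ {y} {p} p∈ ¬min =
    ∈-map⁺ (λ q → leader y q , q) (∈-filterᵇ⁺ (not ∘ isBlockMin y) (blockMins z) p∈ (T-not⁺ ¬min))

  encode-injective : ∀ {y y′} → IsPartition y → IsPartition y′ → z ⊑ y → z ⊑ y′ →
                     encode y ≡ encode y′ → y ≡ y′
  encode-injective {y} {y′} Ey Ey′ z⊑y z⊑y′ same = ⊑-antisym
    (λ i∼j → Y′.leader-≡⇒∼ (trans (sym (same-leader _)) (trans (Y.leader-cong i∼j) (same-leader _))))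
    (λ i∼j → Y.leader-≡⇒∼ (trans (same-leader _) (trans (Y′.leader-cong i∼j) (sym (same-leader _)))))
    where
    module Y = Leader Ey
    module Y′ = Leader Ey′
    module Z = Leader Ez
    open IsEquivalence Ez using () renaming (sym to ∼-sym)
    same-leader-on-blockMins : ∀ {p} → p ∈ blockMins z → leader y p ≡ leader y′ p
    same-leader-on-blockMins {p} p∈ with isBlockMin y p in min-y | isBlockMin y′ p in min-y′
    ... | true | true = trans (Y.leader-blockMin (isBlockMin⇒IsBlockMin y p (Equivalence.from T-≡ min-y)))
                              (sym (Y′.leader-blockMin (isBlockMin⇒IsBlockMin y′ p (Equivalence.from T-≡ min-y′))))
    ... | false | _ = ∈-encode⁻ {y′} (subst ((leader y p , p) ∈_) same (∈-encode⁺ {y} p∈ (subst T min-y)))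
    ... | true | false =
      sym (∈-encode⁻ {y} (subst ((leader y′ p , p) ∈_) (sym same) (∈-encode⁺ {y′} p∈ (subst T min-y′))))
    same-leader : ∀ i → leader y i ≡ leader y′ i
    same-leader i = begin
      leader y i            ≡⟨ Y.leader-cong (z⊑y (∼-sym (Z.leader-∼ i))) ⟩
      leader y (leader z i) ≡⟨ same-leader-on-blockMins (∈-blockMins⁺ (Z.leader-isBlockMin i)) ⟩
      leader y′ (leader z i) ≡⟨ Y′.leader-cong (z⊑y′ (Z.leader-∼ i)) ⟩
      leader y′ i           ∎
      where open ≡-Reasoning

  #coarseningsAt≤ : ∀ b → length (filterᵇ (coarseningAt z b) (SetPartitions n))
                          ≤ length (pairs (blockMins x)) ^ (numBlocks z ∸ b)
  #coarseningsAt≤ b = subst (length (filterᵇ (coarseningAt z b) (SetPartitions n)) ≤_)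
                            (listsOf-length (pairs (blockMins x)) (numBlocks z ∸ b))
    (length≤-injection encode _ (Unique.filter⁺ (T? ∘ coarseningAt z b) SetPartitions-unique)
      (λ {y} y∈ → let (y∈SP , z⊑y , at-b) = unpack y∈ in
        subst (λ k → encode y ∈ listsOf (pairs (blockMins x)) k)
              (trans (encode-length z⊑y) (cong (numBlocks z ∸_) at-b))
              (∈-listsOf⁺ (encode-pairs (∈-SetPartitions⇒IsPartition y∈SP) z⊑y)))
      (λ y∈ y′∈ → let (y∈SP , z⊑y , _) = unpack y∈ ; (y′∈SP , z⊑y′ , _) = unpack y′∈ in
        encode-injective (∈-SetPartitions⇒IsPartition y∈SP) (∈-SetPartitions⇒IsPartition y′∈SP) z⊑y z⊑y′))
    where
    unpack : ∀ {y} → y ∈ filterᵇ (coarseningAt z b) (SetPartitions n) → y ∈ SetPartitions n × z ⊑ y × numBlocks y ≡ b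
    unpack {y} y∈ with ∈-filterᵇ⁻ (coarseningAt z b) (SetPartitions n) y∈
    ... | y∈SP , q with Equivalence.to (T-∧ {z ≤ᵖ y}) q
    ...   | z≤y , at-b = y∈SP , ≤ᵖ⇒⊑ z y z≤y , ≡ᵇ⇒≡ _ _ at-b

-- The Möbius function by levels

coefficient : ℕ → ℕ → ℕ → ℕ
coefficient P b a = if b <ᵇ a then P ^ (a ∸ b) else 0

coefficient-≥ : ∀ P {b a} → a ≤ b → coefficient P b a ≡ 0
coefficient-≥ P {b} {a} a≤b with b <ᵇ a in b<ᵇa
... | false = refl
... | true  = ⊥-elim (≤⇒≯ a≤b (<ᵇ⇒< b a (Equivalence.from T-≡ b<ᵇa)))

coefficient-< : ∀ P {b a} → b < a → coefficient P b a ≡ P ^ (a ∸ b)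
coefficient-< P {b} {a} b<a rewrite Equivalence.to T-≡ (<⇒<ᵇ b<a) = refl

-- With t = c − b the sum is Σ_{j=1}^{t} P^j (2P)^(t−j) = (2P)^t (1 − 2^(−t)), leaving room for P^t.
geometric-bound : ∀ P b c → b ≤ c →
  ∑ (upTo (suc c)) (λ a → coefficient P b a * (2 * P) ^ (c ∸ a)) + P ^ (c ∸ b) ≤ (2 * P) ^ (c ∸ b)
geometric-bound P b c b≤c with m≤n⇒m<n∨m≡n b≤c
geometric-bound P b .b _ | inj₂ refl = ≤-reflexive (trans
  (cong₂ _+_ (∑-vanishes (upTo (suc b)) λ {a} a∈ → cong (_* (2 * P) ^ (b ∸ a)) (coefficient-≥ P (≤-pred (∈-upTo⁻ a∈))))
             (cong (P ^_) (n∸n≡0 b)))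
  (cong ((2 * P) ^_) (sym (n∸n≡0 b))))
geometric-bound P b (suc c) _ | inj₁ (s≤s b≤c) = begin
  ∑ (upTo (suc (suc c))) term + P ^ (suc c ∸ b)
    ≡⟨ cong (λ as → ∑ as term + P ^ (suc c ∸ b)) (upTo-∷ʳ (suc c)) ⟨
  ∑ (upTo (suc c) ∷ʳ suc c) term + P ^ (suc c ∸ b)
    ≡⟨ cong (_+ P ^ (suc c ∸ b)) (∑-++ term (upTo (suc c)) (suc c ∷ [])) ⟩
  ∑ (upTo (suc c)) term + (term (suc c) + 0) + P ^ (suc c ∸ b)
    ≡⟨ cong₂ (λ s t → s + t + P ^ (suc c ∸ b)) earlier (trans (+-identityʳ _) last) ⟩
  2 * P * S + P * P ^ j + P ^ (suc c ∸ b)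
    ≡⟨ cong (λ e → 2 * P * S + P * P ^ j + P ^ e) suc-j ⟩
  2 * P * S + P * P ^ j + P * P ^ j
    ≡⟨ solve 3 (λ P S Q → con 2 :* P :* S :+ P :* Q :+ P :* Q := con 2 :* P :* (S :+ Q)) refl P S (P ^ j) ⟩
  2 * P * (S + P ^ j)
    ≤⟨ *-monoʳ-≤ (2 * P) (geometric-bound P b c b≤c) ⟩
  2 * P * (2 * P) ^ j
    ≡⟨ cong ((2 * P) ^_) suc-j ⟨
  (2 * P) ^ (suc c ∸ b) ∎
  where
  open ≤-Reasoning
  open +-*-Solver
  j = c ∸ b
  suc-j : suc c ∸ b ≡ suc j
  suc-j = +-∸-assoc 1 b≤c
  term : ℕ → ℕ
  term a = coefficient P b a * (2 * P) ^ (suc c ∸ a)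
  S = ∑ (upTo (suc c)) (λ a → coefficient P b a * (2 * P) ^ (c ∸ a))
  earlier : ∑ (upTo (suc c)) term ≡ 2 * P * S
  earlier = trans (∑-cong (upTo (suc c)) λ {a} a∈ → trans
      (cong (λ e → coefficient P b a * (2 * P) ^ e) (+-∸-assoc 1 (≤-pred (∈-upTo⁻ a∈))))
      (*-CS.x∙yz≈y∙xz (coefficient P b a) (2 * P) ((2 * P) ^ (c ∸ a))))
    (sym (*-distribˡ-∑ (2 * P) _ (upTo (suc c))))
  last : term (suc c) ≡ P * P ^ j
  last rewrite coefficient-< P (s≤s b≤c) | n∸n≡0 (suc c) | suc-j = *-identityʳ _

module MöbiusMass {n : ℕ} (x : Rel n) where

  SP : List (Rel n)
  SP = SetPartitions n

  c P : ℕ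
  c = numBlocks x
  P = length (pairs (blockMins x))

  atLevel : ℕ → Rel n → Bool
  atLevel b y = (x ≤ᵖ y) ∧ (numBlocks y ≡ᵇ b)

  between : Rel n → Rel n → Bool
  between y z = (x ≤ᵖ z) ∧ (z ≤ᵖ y) ∧ not (y ≤ᵖ z)

  ∣μ∣ : ℕ → Rel n → ℕ
  ∣μ∣ f y = ∣ mobiusF f x y ∣

  mass : ℕ → ℕ → ℕ
  mass f b = ∑ SP (λ y → if atLevel b y then ∣μ∣ f y else 0)

  ∣μ∣-step : ∀ f y → ∣μ∣ (suc f) y ≤ (if y ≤ᵖ x then 1 else 0) + ∑ SP (λ z → if between y z then ∣μ∣ f z else 0)
  ∣μ∣-step f y with y ≤ᵖ x
  ... | true  = s≤s z≤n
  ... | false = begin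
    ∣ -ℤ sumℤ (map (mobiusF f x) (filterᵇ (between y) SP)) ∣
      ≡⟨ ∣-i∣≡∣i∣ (sumℤ (map (mobiusF f x) (filterᵇ (between y) SP))) ⟩
    ∣ sumℤ (map (mobiusF f x) (filterᵇ (between y) SP)) ∣
      ≤⟨ ∣sumℤ∣≤∑∣∣ (mobiusF f x) (filterᵇ (between y) SP) ⟩
    ∑ (filterᵇ (between y) SP) (∣μ∣ f)
      ≡⟨ ∑-filterᵇ (between y) (∣μ∣ f) SP ⟩
    ∑ SP (λ z → if between y z then ∣μ∣ f z else 0) ∎
    where open ≤-Reasoning

  #equalPartitions≤1 : length (filterᵇ (λ y → (x ≤ᵖ y) ∧ (y ≤ᵖ x)) SP) ≤ 1
  #equalPartitions≤1 =
    length≤-injection (λ _ → tt) (tt ∷ []) (Unique.filter⁺ (T? ∘ λ y → (x ≤ᵖ y) ∧ (y ≤ᵖ x)) SetPartitions-unique)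
      (λ _ → here refl) (λ y∈ y′∈ _ → trans (equal y∈) (sym (equal y′∈)))
    where
    equal : ∀ {y} → y ∈ filterᵇ (λ y → (x ≤ᵖ y) ∧ (y ≤ᵖ x)) SP → y ≡ x
    equal {y} y∈ with Equivalence.to (T-∧ {x ≤ᵖ y}) (proj₂ (∈-filterᵇ⁻ (λ y → (x ≤ᵖ y) ∧ (y ≤ᵖ x)) SP y∈))
    ... | x≤y , y≤x = ⊑-antisym (≤ᵖ⇒⊑ y x y≤x) (≤ᵖ⇒⊑ x y x≤y)

  diagonal-bound : ∀ b → ∑ SP (λ y → if atLevel b y then (if y ≤ᵖ x then 1 else 0) else 0)
                         ≤ (if b ≡ᵇ c then 1 else 0)
  diagonal-bound b with b ≡ᵇ c in b≡ᵇc
  ... | true  = begin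
    ∑ SP (λ y → if atLevel b y then (if y ≤ᵖ x then 1 else 0) else 0)
      ≤⟨ ∑-mono-≤ SP (λ {y} _ → drop-level y) ⟩
    ∑ SP (λ y → if (x ≤ᵖ y) ∧ (y ≤ᵖ x) then 1 else 0)
      ≡⟨ ∑-indicator (λ y → (x ≤ᵖ y) ∧ (y ≤ᵖ x)) SP ⟩
    length (filterᵇ (λ y → (x ≤ᵖ y) ∧ (y ≤ᵖ x)) SP)
      ≤⟨ #equalPartitions≤1 ⟩
    1 ∎
    where
    open ≤-Reasoning
    drop-level : ∀ y → (if atLevel b y then (if y ≤ᵖ x then 1 else 0) else 0)
                       ≤ (if (x ≤ᵖ y) ∧ (y ≤ᵖ x) then 1 else 0)
    drop-level y with x ≤ᵖ y
    ... | false = z≤n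
    ... | true with numBlocks y ≡ᵇ b
    ...   | false = z≤n
    ...   | true  = ≤-refl
  ... | false = ≤-reflexive (∑-vanishes SP λ {y} _ → vanish y)
    where
    vanish : ∀ y → (if atLevel b y then (if y ≤ᵖ x then 1 else 0) else 0) ≡ 0
    vanish y with x ≤ᵖ y in x≤y
    ... | false = refl
    ... | true with numBlocks y ≡ᵇ b in at-b
    ...   | false = refl
    ...   | true with y ≤ᵖ x in y≤x
    ...     | false = refl
    ...     | true  = ⊥-elim (subst T b≡ᵇc (≡⇒≡ᵇ b c (begin
      b           ≡⟨ ≡ᵇ⇒≡ (numBlocks y) b (Equivalence.from T-≡ at-b) ⟨
      numBlocks y ≡⟨ cong numBlocks (⊑-antisym (≤ᵖ⇒⊑ y x (Equivalence.from T-≡ y≤x))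
                                                (≤ᵖ⇒⊑ x y (Equivalence.from T-≡ x≤y))) ⟩
      c           ∎)))
      where open ≡-Reasoning

  atLevel⁻ : ∀ b y → T (atLevel b y) → x ⊑ y × numBlocks y ≡ b
  atLevel⁻ b y at with Equivalence.to (T-∧ {x ≤ᵖ y}) at
  ... | x≤y , #y≡b = ≤ᵖ⇒⊑ x y x≤y , ≡ᵇ⇒≡ (numBlocks y) b #y≡b

  between⁻ : ∀ y z → T (between y z) → x ⊑ z × z ⊑ y × ¬ y ⊑ z
  between⁻ y z bt with Equivalence.to (T-∧ {x ≤ᵖ z}) bt
  ... | x≤z , rest with Equivalence.to (T-∧ {z ≤ᵖ y}) rest
  ...   | z≤y , y≰z = ≤ᵖ⇒⊑ x z x≤z , ≤ᵖ⇒⊑ z y z≤y , T-not⁻ y≰z ∘ ⊑⇒≤ᵖ y z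

  level-below : ∀ {b y z} → y ∈ SP → z ∈ SP → T (atLevel b y) → T (between y z) → b < numBlocks z
  level-below {b} {y} {z} y∈ z∈ at bt with atLevel⁻ b y at | between⁻ y z bt
  ... | _ , refl | _ , z⊑y , y⋢z with m≤n⇒m<n∨m≡n (numBlocks-antitone z⊑y)
  ...   | inj₁ #y<#z = #y<#z
  ...   | inj₂ #y≡#z = ⊥-elim (y⋢z (⊑-numBlocks-≡ (∈-SetPartitions⇒IsPartition z∈)
                                                    (∈-SetPartitions⇒IsPartition y∈) z⊑y #y≡#z))

  coarsenings-bound : ∀ f b {z} → z ∈ SP →
    ∑ SP (λ y → if atLevel b y then (if between y z then ∣μ∣ f z else 0) else 0)
      ≤ (if x ≤ᵖ z then coefficient P b (numBlocks z) * ∣μ∣ f z else 0)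
  coarsenings-bound f b {z} z∈ with T? (x ≤ᵖ z) | T? (b <ᵇ numBlocks z)
  ... | no x≰z | _ = ≤-reflexive (trans (∑-vanishes SP λ {y} _ → vanish y) (sym (if-false x≰z)))
    where
    vanish : ∀ y → (if atLevel b y then (if between y z then ∣μ∣ f z else 0) else 0) ≡ 0
    vanish y = trans (cong (λ t → if atLevel b y then t else 0)
                           (if-false (x≰z ∘ ⊑⇒≤ᵖ x z ∘ proj₁ ∘ between⁻ y z)))
                     (if-same (atLevel b y))
  ... | yes x≤z | no b≮#z = ≤-trans (≤-reflexive (∑-vanishes SP λ {y} y∈ → vanish y y∈)) z≤n
    where
    vanish : ∀ y → y ∈ SP → (if atLevel b y then (if between y z then ∣μ∣ f z else 0) else 0) ≡ 0
    vanish y y∈ with T? (atLevel b y) | T? (between y z)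
    ... | no ¬at | _      = if-false ¬at
    ... | yes at | no ¬bt = trans (if-true at) (if-false ¬bt)
    ... | yes at | yes bt = ⊥-elim (b≮#z (<⇒<ᵇ (level-below y∈ z∈ at bt)))
  ... | yes x≤z | yes b<#z = begin
    ∑ SP (λ y → if atLevel b y then (if between y z then ∣μ∣ f z else 0) else 0)
      ≤⟨ ∑-mono-≤ SP (λ {y} _ → term≤ y) ⟩
    ∑ SP (λ y → ∣μ∣ f z * (if coarseningAt z b y then 1 else 0))
      ≡⟨ *-distribˡ-∑ (∣μ∣ f z) _ SP ⟨
    ∣μ∣ f z * ∑ SP (λ y → if coarseningAt z b y then 1 else 0)
      ≡⟨ cong (∣μ∣ f z *_) (∑-indicator (coarseningAt z b) SP) ⟩
    ∣μ∣ f z * length (filterᵇ (coarseningAt z b) SP)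
      ≤⟨ *-monoʳ-≤ (∣μ∣ f z) (Coarsenings.#coarseningsAt≤ x z (∈-SetPartitions⇒IsPartition z∈) (≤ᵖ⇒⊑ x z x≤z) b) ⟩
    ∣μ∣ f z * P ^ (numBlocks z ∸ b)
      ≡⟨ *-comm (∣μ∣ f z) _ ⟩
    P ^ (numBlocks z ∸ b) * ∣μ∣ f z
      ≡⟨ cong (_* ∣μ∣ f z) (coefficient-< P (<ᵇ⇒< b (numBlocks z) b<#z)) ⟨
    coefficient P b (numBlocks z) * ∣μ∣ f z
      ≡⟨ if-true x≤z ⟨
    (if x ≤ᵖ z then coefficient P b (numBlocks z) * ∣μ∣ f z else 0) ∎
    where
    open ≤-Reasoning
    term≤ : ∀ y → (if atLevel b y then (if between y z then ∣μ∣ f z else 0) else 0)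
                  ≤ ∣μ∣ f z * (if coarseningAt z b y then 1 else 0)
    term≤ y with T? (atLevel b y) | T? (between y z)
    ... | no ¬at | _      = ≤-trans (≤-reflexive (if-false ¬at)) z≤n
    ... | yes at | no ¬bt = ≤-trans (≤-reflexive (trans (if-true at) (if-false ¬bt))) z≤n
    ... | yes at | yes bt = ≤-reflexive (begin-equality
      (if atLevel b y then (if between y z then ∣μ∣ f z else 0) else 0) ≡⟨ trans (if-true at) (if-true bt) ⟩
      ∣μ∣ f z                                                          ≡⟨ *-identityʳ (∣μ∣ f z) ⟨
      ∣μ∣ f z * 1                                                      ≡⟨ cong (∣μ∣ f z *_) (if-true coarse) ⟨
      ∣μ∣ f z * (if coarseningAt z b y then 1 else 0)                  ∎)
      where
      coarse : T (coarseningAt z b y)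
      coarse = Equivalence.from T-∧ (⊑⇒≤ᵖ z y (proj₁ (proj₂ (between⁻ y z bt))) ,
                                     ≡⇒≡ᵇ (numBlocks y) b (proj₂ (atLevel⁻ b y at)))

  ∑-by-level : ∀ (g : ℕ → ℕ) f →
    ∑ SP (λ z → if x ≤ᵖ z then g (numBlocks z) * ∣μ∣ f z else 0) ≡ ∑ (upTo (suc c)) (λ a → g a * mass f a)
  ∑-by-level g f = begin
    ∑ SP (λ z → if x ≤ᵖ z then g (numBlocks z) * ∣μ∣ f z else 0)
      ≡⟨ ∑-cong SP (λ {z} _ → pick z) ⟨
    ∑ SP (λ z → ∑ (upTo (suc c)) (λ a → g a * (if atLevel a z then ∣μ∣ f z else 0)))
      ≡⟨ ∑-comm (λ z a → g a * (if atLevel a z then ∣μ∣ f z else 0)) SP (upTo (suc c)) ⟩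
    ∑ (upTo (suc c)) (λ a → ∑ SP (λ z → g a * (if atLevel a z then ∣μ∣ f z else 0)))
      ≡⟨ ∑-cong (upTo (suc c)) (λ {a} _ → *-distribˡ-∑ (g a) _ SP) ⟨
    ∑ (upTo (suc c)) (λ a → g a * mass f a) ∎
    where
    open ≡-Reasoning
    pick : ∀ z → ∑ (upTo (suc c)) (λ a → g a * (if atLevel a z then ∣μ∣ f z else 0))
               ≡ (if x ≤ᵖ z then g (numBlocks z) * ∣μ∣ f z else 0)
    pick z with T? (x ≤ᵖ z)
    ... | no x≰z = trans (∑-vanishes (upTo (suc c)) λ {a} _ →
                            trans (cong (g a *_) (if-false (x≰z ∘ proj₁ ∘ Equivalence.to T-∧))) (*-zeroʳ (g a)))
                         (sym (if-false x≰z))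
    ... | yes x≤z = begin
      ∑ (upTo (suc c)) (λ a → g a * (if atLevel a z then ∣μ∣ f z else 0))
        ≡⟨ ∑-cong (upTo (suc c)) (λ {a} _ → trans (cong (λ t → g a * (if t then ∣μ∣ f z else 0)) (∧-trueˡ x≤z))
                                                 (*-if (numBlocks z ≡ᵇ a) (g a) (∣μ∣ f z))) ⟩
      ∑ (upTo (suc c)) (λ a → if numBlocks z ≡ᵇ a then g a * ∣μ∣ f z else 0)
        ≡⟨ ∑-pick (λ a → g a * ∣μ∣ f z) (Unique.upTo⁺ (suc c)) (∈-upTo⁺ (s≤s (numBlocks-antitone (≤ᵖ⇒⊑ x z x≤z)))) ⟩
      g (numBlocks z) * ∣μ∣ f z
        ≡⟨ if-true x≤z ⟨
      (if x ≤ᵖ z then g (numBlocks z) * ∣μ∣ f z else 0) ∎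
      where
      ∧-trueˡ : ∀ {p q} → T p → (p ∧ q) ≡ q
      ∧-trueˡ {true} _ = refl

  mass-step : ∀ f b → mass (suc f) b
                    ≤ (if b ≡ᵇ c then 1 else 0) + ∑ (upTo (suc c)) (λ a → coefficient P b a * mass f a)
  mass-step f b = begin
    ∑ SP (λ y → if atLevel b y then ∣μ∣ (suc f) y else 0)
      ≤⟨ ∑-mono-≤ SP (λ {y} _ → if-mono-≤ (atLevel b y) (∣μ∣-step f y)) ⟩
    ∑ SP (λ y → if atLevel b y then diagonal y + below y else 0)
      ≡⟨ ∑-cong SP (λ {y} _ → if-+ (atLevel b y) (diagonal y) (below y)) ⟩
    ∑ SP (λ y → (if atLevel b y then diagonal y else 0) + (if atLevel b y then below y else 0))
      ≡⟨ ∑-distrib-+ _ _ SP ⟩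
    ∑ SP (λ y → if atLevel b y then diagonal y else 0) + ∑ SP (λ y → if atLevel b y then below y else 0)
      ≤⟨ +-monoˡ-≤ _ (diagonal-bound b) ⟩
    (if b ≡ᵇ c then 1 else 0) + ∑ SP (λ y → if atLevel b y then below y else 0)
      ≡⟨ cong ((if b ≡ᵇ c then 1 else 0) +_) (begin-equality
           ∑ SP (λ y → if atLevel b y then below y else 0)
             ≡⟨ ∑-cong SP (λ {y} _ → ∑-if (atLevel b y) _ SP) ⟩
           ∑ SP (λ y → ∑ SP (λ z → if atLevel b y then (if between y z then ∣μ∣ f z else 0) else 0))
             ≡⟨ ∑-comm (λ y z → if atLevel b y then (if between y z then ∣μ∣ f z else 0) else 0) SP SP ⟩
           ∑ SP (λ z → ∑ SP (λ y → if atLevel b y then (if between y z then ∣μ∣ f z else 0) else 0)) ∎) ⟩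
    (if b ≡ᵇ c then 1 else 0) + ∑ SP (λ z → ∑ SP (λ y → if atLevel b y then (if between y z then ∣μ∣ f z else 0) else 0))
      ≤⟨ +-monoʳ-≤ (if b ≡ᵇ c then 1 else 0) (∑-mono-≤ SP (coarsenings-bound f b)) ⟩
    (if b ≡ᵇ c then 1 else 0) + ∑ SP (λ z → if x ≤ᵖ z then coefficient P b (numBlocks z) * ∣μ∣ f z else 0)
      ≡⟨ cong ((if b ≡ᵇ c then 1 else 0) +_) (∑-by-level (coefficient P b) f) ⟩
    (if b ≡ᵇ c then 1 else 0) + ∑ (upTo (suc c)) (λ a → coefficient P b a * mass f a) ∎
    where
    open ≤-Reasoning
    diagonal below : Rel n → ℕ
    diagonal y = if y ≤ᵖ x then 1 else 0
    below y = ∑ SP (λ z → if between y z then ∣μ∣ f z else 0)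

  mass-bound : ∀ f b → b ≤ c → mass f b ≤ (2 * P) ^ (c ∸ b)
  mass-bound zero    b _   = ≤-trans (≤-reflexive (∑-vanishes SP λ {y} _ → if-same (atLevel b y))) z≤n
  mass-bound (suc f) b b≤c = begin
    mass (suc f) b
      ≤⟨ mass-step f b ⟩
    (if b ≡ᵇ c then 1 else 0) + ∑ (upTo (suc c)) (λ a → coefficient P b a * mass f a)
      ≤⟨ +-mono-≤ diagonal≤ (∑-mono-≤ (upTo (suc c)) λ {a} a∈ →
           *-monoʳ-≤ (coefficient P b a) (mass-bound f a (≤-pred (∈-upTo⁻ a∈)))) ⟩
    P ^ (c ∸ b) + ∑ (upTo (suc c)) (λ a → coefficient P b a * (2 * P) ^ (c ∸ a))
      ≡⟨ +-comm (P ^ (c ∸ b)) _ ⟩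
    ∑ (upTo (suc c)) (λ a → coefficient P b a * (2 * P) ^ (c ∸ a)) + P ^ (c ∸ b)
      ≤⟨ geometric-bound P b c b≤c ⟩
    (2 * P) ^ (c ∸ b) ∎
    where
    open ≤-Reasoning
    diagonal≤ : (if b ≡ᵇ c then 1 else 0) ≤ P ^ (c ∸ b)
    diagonal≤ with T? (b ≡ᵇ c)
    ... | no b≢c = ≤-trans (≤-reflexive (if-false b≢c)) z≤n
    ... | yes b≡c rewrite if-true {t = 1} {e = 0} b≡c | ≡ᵇ⇒≡ b c b≡c | n∸n≡0 c = ≤-refl

  mass-above : ∀ f b → c < b → mass f b ≡ 0
  mass-above f b c<b = ∑-vanishes SP λ {y} _ → vanish y
    where
    vanish : ∀ y → (if atLevel b y then ∣μ∣ f y else 0) ≡ 0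
    vanish y with T? (atLevel b y)
    ... | no ¬at = if-false ¬at
    ... | yes at with atLevel⁻ b y at
    ...   | x⊑y , refl = ⊥-elim (<⇒≱ c<b (numBlocks-antitone x⊑y))

-- Compositions

powers-bound : ∀ m N k → ∑ (upTo N) (λ j → if j <ᵇ suc k then m ^ (k ∸ j) else 0) ≤ suc m ^ k
powers-bound m zero    k       = z≤n
powers-bound m (suc N) zero    rewrite ∑-upTo-suc (λ j → if j <ᵇ 1 then m ^ (0 ∸ j) else 0) N =
  ≤-reflexive (cong suc (∑-vanishes (upTo N) λ _ → refl))
powers-bound m (suc N) (suc k) rewrite ∑-upTo-suc (λ j → if j <ᵇ suc (suc k) then m ^ (suc k ∸ j) else 0) N = begin
  m ^ suc k + ∑ (upTo N) (λ j → if j <ᵇ suc k then m ^ (k ∸ j) else 0)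
    ≤⟨ +-mono-≤ (*-monoʳ-≤ m (^-monoˡ-≤ k (n≤1+n m))) (powers-bound m N k) ⟩
  m * suc m ^ k + suc m ^ k
    ≡⟨ +-comm (m * suc m ^ k) _ ⟩
  suc m ^ suc k ∎
  where open ≤-Reasoning

factorial-product : ∀ a b → suc a ! * suc b ! ≤ suc (a + b) !
factorial-product a zero    rewrite +-identityʳ a | *-identityʳ (suc a !) = ≤-refl
factorial-product a (suc b) = begin
  suc a ! * (suc (suc b) * suc b !)  ≡⟨ *-CS.x∙yz≈y∙xz (suc a !) (suc (suc b)) (suc b !) ⟩
  suc (suc b) * (suc a ! * suc b !)  ≤⟨ *-mono-≤ (s≤s (s≤s (m≤n+m b a))) (factorial-product a b) ⟩
  suc (suc (a + b)) * suc (a + b) !  ≡⟨ cong (λ t → suc t !) (+-suc a b) ⟨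
  suc (a + suc b) !                  ∎
  where open ≤-Reasoning

+-≡ᵇ-cancelˡ : ∀ a s t → (a + s ≡ᵇ a + t) ≡ (s ≡ᵇ t)
+-≡ᵇ-cancelˡ zero    s t = refl
+-≡ᵇ-cancelˡ (suc a) s t = +-≡ᵇ-cancelˡ a s t

length≤sum : {l : List ℕ} → All (1 ≤_) l → length l ≤ sum l
length≤sum []           = z≤n
length≤sum (1≤a ∷ 1≤l) = +-mono-≤ 1≤a (length≤sum 1≤l)

module Compositions (n : ℕ) where

  compositionMass : ℕ → ℕ → ℕ
  compositionMass m s = ∑ (listsOf (oneTo n) m) (λ l → if sum l ≡ᵇ s then partFactorial l else 0)

  oneTo-positive : ∀ {a} → a ∈ oneTo n → 1 ≤ a
  oneTo-positive a∈ with ∈-map⁻ suc a∈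
  ... | _ , _ , refl = s≤s z≤n

  compositionMass-bound : ∀ m k → compositionMass m (m + k) ≤ m ^ k * suc k !
  compositionMass-bound zero    zero    = ≤-refl
  compositionMass-bound zero    (suc k) = z≤n
  compositionMass-bound (suc m) k = begin
    ∑ (concatMap (λ a → map (a ∷_) V) (oneTo n)) F       ≡⟨ ∑-concatMap F (λ a → map (a ∷_) V) (oneTo n) ⟩
    ∑ (oneTo n) (λ a → ∑ (map (a ∷_) V) F)               ≡⟨ ∑-map (λ a → ∑ (map (a ∷_) V) F) suc (upTo n) ⟩
    ∑ (upTo n) (λ j → ∑ (map (suc j ∷_) V) F)            ≡⟨ ∑-cong (upTo n) (λ {j} _ → ∑-map F (suc j ∷_) V) ⟩
    ∑ (upTo n) (λ j → ∑ V (λ l → F (suc j ∷ l)))         ≤⟨ ∑-mono-≤ (upTo n) (λ {j} _ → first-part j) ⟩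
    ∑ (upTo n) (λ j → suc k ! * weight j)                ≡⟨ *-distribˡ-∑ (suc k !) weight (upTo n) ⟨
    suc k ! * ∑ (upTo n) weight                          ≤⟨ *-monoʳ-≤ (suc k !) (powers-bound m n k) ⟩
    suc k ! * suc m ^ k                                  ≡⟨ *-comm (suc k !) _ ⟩
    suc m ^ k * suc k !                                  ∎
    where
    open ≤-Reasoning
    V = listsOf (oneTo n) m
    F : List ℕ → ℕ
    F l = if sum l ≡ᵇ suc m + k then partFactorial l else 0
    weight : ℕ → ℕ
    weight j = if j <ᵇ suc k then m ^ (k ∸ j) else 0
    m≤sum : ∀ {l} → l ∈ V → m ≤ sum l
    m≤sum l∈ with ∈-listsOf⁻ m l∈
    ... | refl , l⊆ = length≤sum (All.map oneTo-positive l⊆)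
    first-part : ∀ j → ∑ V (λ l → F (suc j ∷ l)) ≤ suc k ! * weight j
    first-part j with T? (j <ᵇ suc k)
    ... | no j≮1+k = ≤-trans (≤-reflexive (∑-vanishes V λ {l} l∈ → if-false {b = suc j + sum l ≡ᵇ suc m + k} λ eq →
            <-irrefl refl (≤-trans (+-mono-≤ (≮⇒≥ (j≮1+k ∘ <⇒<ᵇ)) (m≤sum l∈)) (≤-reflexive (trans
              (suc-injective (≡ᵇ⇒≡ (suc j + sum l) (suc m + k) eq)) (+-comm m k)))))) z≤n
    ... | yes j<1+k = begin
      ∑ V (λ l → F (suc j ∷ l))
        ≡⟨ ∑-cong V (λ {l} _ → split-first l) ⟩
      ∑ V (λ l → suc j ! * (if sum l ≡ᵇ m + t then partFactorial l else 0))
        ≡⟨ *-distribˡ-∑ (suc j !) _ V ⟨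
      suc j ! * compositionMass m (m + t)
        ≤⟨ *-monoʳ-≤ (suc j !) (compositionMass-bound m t) ⟩
      suc j ! * (m ^ t * suc t !)
        ≡⟨ *-CS.x∙yz≈y∙xz (suc j !) (m ^ t) (suc t !) ⟩
      m ^ t * (suc j ! * suc t !)
        ≤⟨ *-monoʳ-≤ (m ^ t) (factorial-product j t) ⟩
      m ^ t * suc (j + t) !
        ≡⟨ cong (λ e → m ^ t * suc e !) (m+[n∸m]≡n j≤k) ⟩
      m ^ t * suc k !
        ≡⟨ trans (*-comm (m ^ t) (suc k !)) (cong (suc k ! *_) (sym (if-true j<1+k))) ⟩
      suc k ! * weight j ∎
      where
      t = k ∸ j
      j≤k = ≤-pred (<ᵇ⇒< j (suc k) j<1+k)
      total : suc m + k ≡ suc j + (m + t)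
      total = cong suc (trans (cong (m +_) (sym (m+[n∸m]≡n j≤k))) (+-CS.x∙yz≈y∙xz m j t))
      split-first : ∀ l → F (suc j ∷ l) ≡ suc j ! * (if sum l ≡ᵇ m + t then partFactorial l else 0)
      split-first l = begin-equality
        F (suc j ∷ l)
          ≡⟨ cong (λ e → if suc j + sum l ≡ᵇ e then suc j ! * partFactorial l else 0) total ⟩
        (if suc j + sum l ≡ᵇ suc j + (m + t) then suc j ! * partFactorial l else 0)
          ≡⟨ cong (λ b → if b then suc j ! * partFactorial l else 0) (+-≡ᵇ-cancelˡ (suc j) (sum l) (m + t)) ⟩
        (if sum l ≡ᵇ m + t then suc j ! * partFactorial l else 0)
          ≡⟨ *-if (sum l ≡ᵇ m + t) (suc j !) (partFactorial l) ⟨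
        suc j ! * (if sum l ≡ᵇ m + t then partFactorial l else 0) ∎

segment-< : (xs : List ℕ) {i : ℕ} → i < sum xs → segment xs i < length xs
segment-< (a ∷ as) {i} i<sum with i <ᵇ a in i<ᵇa
... | true  = s≤s z≤n
... | false = s≤s (segment-< as (subst (i ∸ a <_) (m+n∸m≡n a (sum as)) (∸-monoˡ-< i<sum a≤i)))
  where
  a≤i : a ≤ i
  a≤i = ≮⇒≥ λ i<a → subst T i<ᵇa (<⇒<ᵇ i<a)

numBlocks-Πof : ∀ {n} (xs : List ℕ) → sum xs ≡ n → numBlocks (Πof n xs) ≤ length xs
numBlocks-Πof {n} xs refl = numBlocks-kernel {n} {λ i → segment xs (toℕ i)} λ i → segment-< xs (toℕ<n i)

innerSum-bound : ∀ n d {xs : List ℕ} → sum xs ≡ n →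
  innerSum n d xs ≤ (length xs * length xs) ^ (length xs ∸ (n ∸ d))
innerSum-bound n d {xs} sum≡n = bound ((n ∸ d) ≤? c)
  where
  open MöbiusMass (Πof n xs)
  ℓ = length xs
  innerSum≡mass : innerSum n d xs ≡ mass (suc n) (n ∸ d)
  innerSum≡mass = ∑-filterᵇ (atLevel (n ∸ d)) (∣μ∣ (suc n)) SP
  c≤ℓ : c ≤ ℓ
  c≤ℓ = numBlocks-Πof xs sum≡n
  raise-exponent : ∀ {c ℓ} → c ≤ ℓ → (ℓ * ℓ) ^ (c ∸ (n ∸ d)) ≤ (ℓ * ℓ) ^ (ℓ ∸ (n ∸ d))
  raise-exponent {ℓ = zero}  z≤n = ≤-refl
  raise-exponent {ℓ = suc ℓ} c≤ℓ = ^-monoʳ-≤ (suc ℓ * suc ℓ) (∸-monoˡ-≤ (n ∸ d) c≤ℓ)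
  bound : Dec (n ∸ d ≤ c) → innerSum n d xs ≤ (ℓ * ℓ) ^ (ℓ ∸ (n ∸ d))
  bound (no b≰c) = ≤-trans (≤-reflexive (trans innerSum≡mass (mass-above (suc n) (n ∸ d) (≰⇒> b≰c)))) z≤n
  bound (yes b≤c) = begin
    innerSum n d xs                ≡⟨ innerSum≡mass ⟩
    mass (suc n) (n ∸ d)           ≤⟨ mass-bound (suc n) (n ∸ d) b≤c ⟩
    (2 * P) ^ (c ∸ (n ∸ d))        ≤⟨ ^-monoˡ-≤ (c ∸ (n ∸ d)) (length-pairs (blockMins (Πof n xs))) ⟩
    (c * c) ^ (c ∸ (n ∸ d))        ≤⟨ ^-monoˡ-≤ (c ∸ (n ∸ d)) (*-mono-≤ c≤ℓ c≤ℓ) ⟩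
    (ℓ * ℓ) ^ (c ∸ (n ∸ d))        ≤⟨ raise-exponent c≤ℓ ⟩
    (ℓ * ℓ) ^ (ℓ ∸ (n ∸ d))        ∎
    where open ≤-Reasoning

lhs≤compositionMass : ∀ n d k → k ≤ d → d ≤ n →
  lhs n d k ≤ ((n ∸ k) * (n ∸ k)) ^ (d ∸ k) * Compositions.compositionMass n (n ∸ k) n
lhs≤compositionMass n d k k≤d d≤n = begin
  lhs n d k
    ≡⟨ ∑-filterᵇ isPartitionOfN g (listsOf (oneTo n) m) ⟩
  ∑ (listsOf (oneTo n) m) (λ xs → if isPartitionOfN xs then g xs else 0)
    ≤⟨ ∑-mono-≤ (listsOf (oneTo n) m) (λ {xs} xs∈ → term≤ xs xs∈) ⟩
  ∑ (listsOf (oneTo n) m) (λ xs → K * (if sum xs ≡ᵇ n then partFactorial xs else 0))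
    ≡⟨ *-distribˡ-∑ K _ (listsOf (oneTo n) m) ⟨
  K * Compositions.compositionMass n m n ∎
  where
  open ≤-Reasoning
  m = n ∸ k
  K = (m * m) ^ (d ∸ k)
  isPartitionOfN : List ℕ → Bool
  isPartitionOfN xs = nonincreasing xs ∧ (sum xs ≡ᵇ n)
  g : List ℕ → ℕ
  g xs = partFactorial xs * innerSum n d xs
  exponent : m ∸ (n ∸ d) ≡ d ∸ k
  exponent = begin-equality
    (n ∸ k) ∸ (n ∸ d)                  ≡⟨ cong (λ e → (e ∸ k) ∸ (n ∸ d)) (m∸n+n≡m d≤n) ⟨
    ((n ∸ d) + d) ∸ k ∸ (n ∸ d)        ≡⟨ cong (_∸ (n ∸ d)) (+-∸-assoc (n ∸ d) k≤d) ⟩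
    (n ∸ d) + (d ∸ k) ∸ (n ∸ d)        ≡⟨ m+n∸m≡n (n ∸ d) (d ∸ k) ⟩
    d ∸ k                              ∎
  term≤ : ∀ xs → xs ∈ listsOf (oneTo n) m →
          (if isPartitionOfN xs then g xs else 0) ≤ K * (if sum xs ≡ᵇ n then partFactorial xs else 0)
  term≤ xs xs∈ with T? (isPartitionOfN xs)
  ... | no ¬p = ≤-trans (≤-reflexive (if-false ¬p)) z≤n
  ... | yes p with ∈-listsOf⁻ m xs∈ | proj₂ (Equivalence.to (T-∧ {nonincreasing xs}) p)
  ...   | length≡m , _ | sum≡ᵇn = begin
    (if isPartitionOfN xs then g xs else 0)          ≡⟨ if-true p ⟩
    partFactorial xs * innerSum n d xs                ≤⟨ *-monoʳ-≤ (partFactorial xs) inner≤ ⟩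
    partFactorial xs * (m * m) ^ (m ∸ (n ∸ d))       ≡⟨ cong (λ e → partFactorial xs * (m * m) ^ e) exponent ⟩
    partFactorial xs * K                             ≡⟨ *-comm (partFactorial xs) K ⟩
    K * partFactorial xs                             ≡⟨ cong (K *_) (if-true sum≡ᵇn) ⟨
    K * (if sum xs ≡ᵇ n then partFactorial xs else 0) ∎
    where
    inner≤ : innerSum n d xs ≤ (m * m) ^ (m ∸ (n ∸ d))
    inner≤ = subst (λ ℓ → innerSum n d xs ≤ (ℓ * ℓ) ^ (ℓ ∸ (n ∸ d))) length≡m
                   (innerSum-bound n d {xs} (≡ᵇ⇒≡ (sum xs) n sum≡ᵇn))

powers-of-square : ∀ m {k d} → k ≤ d → (m * m) ^ (d ∸ k) * m ^ k ≡ m ^ (2 * d ∸ k)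
powers-of-square m {k} {d} k≤d = begin-equality
  (m * m) ^ t * m ^ k      ≡⟨ cong (λ s → s ^ t * m ^ k) (cong (m *_) (*-identityʳ m)) ⟨
  (m ^ 2) ^ t * m ^ k      ≡⟨ cong (_* m ^ k) (^-*-assoc m 2 t) ⟩
  m ^ (2 * t) * m ^ k      ≡⟨ ^-distribˡ-+-* m (2 * t) k ⟨
  m ^ (2 * t + k)          ≡⟨ cong (m ^_) (m+n∸n≡m (2 * t + k) k) ⟨
  m ^ (2 * t + k + k ∸ k)  ≡⟨ cong (λ e → m ^ (e ∸ k)) (trans double (cong (2 *_) (m∸n+n≡m k≤d))) ⟩
  m ^ (2 * d ∸ k)          ∎
  where
  open ≤-Reasoning
  open +-*-Solver
  t = d ∸ k
  double : 2 * t + k + k ≡ 2 * (t + k)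
  double = solve 2 (λ t k → con 2 :* t :+ k :+ k := con 2 :* (t :+ k)) refl t k

lemma3p4 : (n d k : ℕ) → k ≤ d → d ≤ n →
    lhs n d k ≤ (n ∸ k) ^ (2 * d ∸ k) * (suc k) !
lemma3p4 n d k k≤d d≤n = begin
  lhs n d k                      ≤⟨ lhs≤compositionMass n d k k≤d d≤n ⟩
  K * compositionMass m n        ≡⟨ cong (λ s → K * compositionMass m s) (m∸n+n≡m (≤-trans k≤d d≤n)) ⟨
  K * compositionMass m (m + k)  ≤⟨ *-monoʳ-≤ K (compositionMass-bound m k) ⟩
  K * (m ^ k * suc k !)          ≡⟨ *-assoc K (m ^ k) (suc k !) ⟨
  K * m ^ k * suc k !            ≡⟨ cong (_* suc k !) (powers-of-square m k≤d) ⟩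
  m ^ (2 * d ∸ k) * suc k !      ∎
  where
  open ≤-Reasoning
  open Compositions n
  m = n ∸ k
  K = (m * m) ^ (d ∸ k)
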